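{- Let $w$ be a word of length $n$, let $1\le m\le n$, let $\mathcal{S}$ be the $m$-staircase covering $w$, and let $F$ be any factorization of $w$. Then $|\mathit{Reduce}(\mathcal{S},F)|\le 4(|F|-1)$.
   Context: A factorization of $w$ is a sequence $F=(f_1,\dots,f_K)$ with $w=f_1\cdots f_K$ such that each $f_k$ is a subword of $f_1\cdots f_{k-1}$ or a single letter; $|F|=K$; each factor occupies an interval of positions of $w$. For $1\le m\le n$, the $m$-staircase covering $w$ is the family $\mathcal{S}=\{[km+1..(k+3)m-1]\cap[1..n] : k=0,1,\dots,\max(0,\lceil n/m\rceil-3)\}\setminus\{\emptyset\}$, where $[a..b]=\{a,\dots,b\}$. $\mathit{Reduce}(\mathcal{S},F)$ is the family of those intervals $[i..j]\in\mathcal{S}$ such that the extended stretch of positions $[i..j+m]$ (restricted to $[1..n]$) does not lie within a single factor of $F$, i.e. it overlaps more than one factor of $F$. -}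

module Defs where

open import Data.Nat using (ℕ; zero; suc; _+_; _*_; _∸_; _≤_; _⊓_; _≤?_)
open import Data.Nat.DivMod using (_/_)
open import Data.List using (List; []; _∷_; _++_; length; map; upTo; filter; concat)
open import Data.List.Relation.Unary.All using (All)
open import Data.List.Relation.Unary.Any using (Any; any?)
open import Data.Product using (_×_; _,_; ∃; ∃₂; proj₁; proj₂)
open import Data.Sum using (_⊎_)
open import Data.Unit using (⊤)
open import Relation.Binary.PropositionalEquality using (_≡_)
open import Relation.Nullary using (¬_; Dec)
open import Relation.Nullary.Decidable using (¬?; _×-dec_)

-- Closed intervals [i..j] of positions (1-based), as pairs (i , j).
Interval : Set
Interval = ℕ × ℕ

IsSubword : {A : Set} → List A → List A → Set
IsSubword u v = ∃₂ λ x y → v ≡ x ++ u ++ y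

-- Each factor f_k (given the concatenation p = f_1 ⋯ f_{k-1} of its
-- predecessors) is a single letter or a nonempty subword of p.
ValidFactor : {A : Set} → List A → List A → Set
ValidFactor p f = (∃ λ a → f ≡ a ∷ []) ⊎ (¬ (f ≡ []) × IsSubword f p)

ValidFactorsFrom : {A : Set} → List A → List (List A) → Set
ValidFactorsFrom p []      = ⊤
ValidFactorsFrom p (f ∷ F) = ValidFactor p f × ValidFactorsFrom (p ++ f) F

IsFactorization : {A : Set} → List A → List (List A) → Set
IsFactorization w F = concat F ≡ w × ValidFactorsFrom [] F

factorIntervalsFrom : {A : Set} → ℕ → List (List A) → List Interval
factorIntervalsFrom s []      = []
factorIntervalsFrom s (f ∷ F) = (suc s , s + length f) ∷ factorIntervalsFrom (s + length f) F

factorIntervals : {A : Set} → List (List A) → List Interval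
factorIntervals = factorIntervalsFrom 0

_⊆I_ : Interval → Interval → Set
(a , b) ⊆I (l , r) = l ≤ a × b ≤ r

_⊆I?_ : (I J : Interval) → Dec (I ⊆I J)
(a , b) ⊆I? (l , r) = (l ≤? a) ×-dec (b ≤? r)

WithinOneFactor : {A : Set} → List (List A) → Interval → Set
WithinOneFactor F I = Any (I ⊆I_) (factorIntervals F)

withinOneFactor? : {A : Set} (F : List (List A)) (I : Interval) → Dec (WithinOneFactor F I)
withinOneFactor? F I = any? (I ⊆I?_) (factorIntervals F)

-- ⌈ n / m ⌉ (defined as 0 when m = 0, a case never used)
ceilDiv : ℕ → ℕ → ℕ
ceilDiv n zero    = 0
ceilDiv n (suc m) = (n + m) / suc m

-- [km+1 .. (k+3)m-1] ∩ [1..n]  (as a pair; empty iff first > second)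
stairStep : ℕ → ℕ → ℕ → Interval
stairStep n m k = (k * m + 1 , ((k + 3) * m ∸ 1) ⊓ n)

NonEmptyI : Interval → Set
NonEmptyI (i , j) = i ≤ j

nonEmptyI? : (I : Interval) → Dec (NonEmptyI I)
nonEmptyI? (i , j) = i ≤? j

-- The m-staircase covering of a word of length n:
-- { [km+1..(k+3)m-1] ∩ [1..n] : k = 0..max(0, ⌈n/m⌉-3) } \ {∅}
-- (ℕ-subtraction ∸ realises max(0, ·)).
staircase : ℕ → ℕ → List Interval
staircase n m =
  filter nonEmptyI? (map (stairStep n m) (upTo (suc (ceilDiv n m ∸ 3))))

extend : ℕ → ℕ → Interval → Interval
extend n m (i , j) = (i , (j + m) ⊓ n)

reduce : {A : Set} → ℕ → ℕ → List Interval → List (List A) → List Interval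
reduce n m S F = filter (λ I → ¬? (withinOneFactor? F (extend n m I))) S

module Submission where

-- Call a position b a cut of F if some factor ends at b and
-- another one starts at b + 1; a factorization F has |F| - 1 cuts.
--   * An interval of positions that lies within no single factor contains
--     a cut b together with b + 1 (`straddlesCut`).
--   * The extended stretch of the k-th staircase step lies in
--     [km+1 .. (k+4)m], so such a cut b satisfies km < b < (k+4)m; we say
--     that b lies in the k-th window (`Window`).
--   * A fixed b lies in at most four windows, because the indices k of
--     those windows differ by less than 4 (`clusteredLength`); hence at
--     most 4(|F| - 1) indices k have a cut in their window (`countHits`).
-- The theorem follows by mapping every step kept by Reduce to its index k,
-- which has a cut in its window.

open import Defs
open import Data.Nat using (ℕ; _≤_; _*_; _∸_; suc; _+_; _<_; _⊓_; _≤?_; _<?_; z≤n; s≤s)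
open import Data.List using (List; length; []; _∷_; _++_; map; upTo; filter; concat)
open import Data.Nat.Properties
open import Data.List.Properties using (length-++)
open import Data.List.Relation.Unary.All using (All; []; _∷_)
import Data.List.Relation.Unary.All as All
open import Data.List.Relation.Unary.All.Properties using (all-filter)
open import Data.List.Relation.Unary.AllPairs using (AllPairs; []; _∷_)
import Data.List.Relation.Unary.AllPairs.Properties as AllPairs
open import Data.List.Relation.Unary.Any using (Any; any?; here; there)
import Data.List.Relation.Unary.Any as Any
open import Data.Product using (_×_; _,_)
open import Data.Sum using (_⊎_; inj₁; inj₂)
open import Data.Empty using (⊥-elim)
open import Function using (_∘_; id)
open import Level using (0ℓ)
open import Relation.Nullary using (¬_; Dec; yes; no)
open import Relation.Nullary.Decidable using (_×-dec_)
open import Relation.Unary using (Pred; Decidable)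
open import Relation.Binary.PropositionalEquality using (_≡_; refl; sym; trans; cong; subst)

module _ {X : Set} where

  length-filter-cons : {P : Pred X 0ℓ} (P? : Decidable P) (x : X) (xs : List X) →
    length (filter P? xs) ≤ length (filter P? (x ∷ xs))
  length-filter-cons P? x xs with P? x
  ... | yes _ = n≤1+n _
  ... | no  _ = ≤-refl

  length-filter-∪ : {P Q S : Pred X 0ℓ} (P? : Decidable P) (Q? : Decidable Q) (S? : Decidable S) →
    (∀ x → P x → Q x ⊎ S x) → (xs : List X) →
    length (filter P? xs) ≤ length (filter Q? xs) + length (filter S? xs)
  length-filter-∪ P? Q? S? P⊆Q∪S [] = z≤n
  length-filter-∪ P? Q? S? P⊆Q∪S (x ∷ xs) with length-filter-∪ P? Q? S? P⊆Q∪S xs | P? x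
  ... | ih | no _ =
    ≤-trans ih (+-mono-≤ (length-filter-cons Q? x xs) (length-filter-cons S? x xs))
  ... | ih | yes px with Q? x
  ...   | yes _ = s≤s (≤-trans ih (+-monoʳ-≤ _ (length-filter-cons S? x xs)))
  ...   | no ¬qx with S? x
  ...     | yes _ = ≤-trans (s≤s ih) (≤-reflexive (sym (+-suc _ _)))
  ...     | no ¬sx with P⊆Q∪S x px
  ...       | inj₁ qx = ⊥-elim (¬qx qx)
  ...       | inj₂ sx = ⊥-elim (¬sx sx)

length-filter²-map : {X Y : Set} {P Q : Pred Y 0ℓ} {C : Pred X 0ℓ}
  (P? : Decidable P) (Q? : Decidable Q) (C? : Decidable C) (g : X → Y) →
  (∀ x → Q (g x) → P (g x) → C x) → (xs : List X) →
  length (filter P? (filter Q? (map g xs))) ≤ length (filter C? xs)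
length-filter²-map P? Q? C? g h [] = z≤n
length-filter²-map P? Q? C? g h (x ∷ xs) with length-filter²-map P? Q? C? g h xs | Q? (g x)
... | ih | no _ = ≤-trans ih (length-filter-cons C? x xs)
... | ih | yes qx with P? (g x)
...   | no _ = ≤-trans ih (length-filter-cons C? x xs)
...   | yes px with C? x
...     | yes _  = s≤s ih
...     | no ¬cx = ⊥-elim (¬cx (h x qx px))

increasing-length : ∀ lo hi {xs : List ℕ} → AllPairs _<_ xs →
  All (λ x → lo ≤ x × x < hi) xs → length xs ≤ hi ∸ lo
increasing-length lo hi [] [] = z≤n
increasing-length lo hi {x ∷ xs} (x<xs ∷ inc) ((lo≤x , x<hi) ∷ inRange) = begin
  suc (length xs)  ≤⟨ s≤s (increasing-length (suc x) hi inc aboveX) ⟩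
  suc (hi ∸ suc x) ≡⟨ sym (+-∸-assoc 1 x<hi) ⟩
  hi ∸ x           ≤⟨ ∸-monoʳ-≤ hi lo≤x ⟩
  hi ∸ lo          ∎
  where
  open ≤-Reasoning
  aboveX : All (λ y → suc x ≤ y × y < hi) xs
  aboveX = All.zipWith (λ (x<y , (_ , y<hi)) → x<y , y<hi) (x<xs , inRange)

clusteredLength : {W : Pred ℕ 0ℓ} (d : ℕ) →
  (∀ {x y} → W x → W y → x < y → y ≤ x + d) →
  {xs : List ℕ} → AllPairs _<_ xs → All W xs → length xs ≤ suc d
clusteredLength d close [] [] = z≤n
clusteredLength d close {x ∷ xs} (x<xs ∷ inc) (wx ∷ wxs) =
  s≤s (subst (length xs ≤_) (m+n∸m≡n (suc x) d)
        (increasing-length (suc x) (suc x + d) inc nearX))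
  where
  nearX : All (λ y → suc x ≤ y × y < suc x + d) xs
  nearX = All.zipWith (λ (x<y , wy) → x<y , s≤s (close wx wy x<y)) (x<xs , wxs)

module Windows (m : ℕ) where

  Window : ℕ → ℕ → Set
  Window b k = k * m < b × b < (k + 4) * m

  window? : (b k : ℕ) → Dec (Window b k)
  window? b k = (k * m <? b) ×-dec (b <? (k + 4) * m)

  Hit : List ℕ → ℕ → Set
  Hit B k = Any (λ b → Window b k) B

  hit? : (B : List ℕ) (k : ℕ) → Dec (Hit B k)
  hit? B k = any? (λ b → window? b k) B

  windowsClose : ∀ {b k l} → Window b k → Window b l → k < l → l ≤ k + 3
  windowsClose {k = k} {l} (_ , b<k+4) (l<b , _) _ =
    <⇒≤pred (subst (l <_) (+-suc k 3) (*-cancelʳ-< m l (k + 4) (<-trans l<b b<k+4)))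

  windowsPerPosition : ∀ b {ks} → AllPairs _<_ ks → length (filter (window? b) ks) ≤ 4
  windowsPerPosition b {ks} inc =
    clusteredLength 3 windowsClose (AllPairs.filter⁺ (window? b) inc) (all-filter (window? b) ks)

  countHits : (B : List ℕ) {ks : List ℕ} → AllPairs _<_ ks → length (filter (hit? B) ks) ≤ 4 * length B
  countHits [] {ks} inc = ≤-reflexive (noHits ks)
    where
    noHits : ∀ ks → length (filter (hit? []) ks) ≡ 0
    noHits [] = refl
    noHits (_ ∷ ks) = noHits ks
  countHits (b ∷ B) {ks} inc = begin
    length (filter (hit? (b ∷ B)) ks)
      ≤⟨ length-filter-∪ (hit? (b ∷ B)) (window? b) (hit? B) headOrTail ks ⟩
    length (filter (window? b) ks) + length (filter (hit? B) ks)
      ≤⟨ +-mono-≤ (windowsPerPosition b inc) (countHits B inc) ⟩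
    4 + 4 * length B
      ≡⟨ sym (*-suc 4 (length B)) ⟩
    4 * length (b ∷ B) ∎
    where
    open ≤-Reasoning
    headOrTail : ∀ k → Hit (b ∷ B) k → Window b k ⊎ Hit B k
    headOrTail k (here w)  = inj₁ w
    headOrTail k (there h) = inj₂ h

  -- A position b with i ≤ b < j inside the extended stretch [i..j] of the
  -- k-th staircase step lies in the k-th window: that stretch is contained
  -- in [km+1 .. (k+4)m].
  stretchInWindow : ∀ n k b → let (i , j) = extend n m (stairStep n m k) in
    i ≤ b → b < j → Window b k
  stretchInWindow n k b i≤b b<j = (subst (_≤ b) (+-comm (k * m) 1) i≤b , <-≤-trans b<j j≤)
    where
    open ≤-Reasoning
    j≤ : ((((k + 3) * m ∸ 1) ⊓ n) + m) ⊓ n ≤ (k + 4) * m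
    j≤ = begin
      ((((k + 3) * m ∸ 1) ⊓ n) + m) ⊓ n ≤⟨ m⊓n≤m _ n ⟩
      (((k + 3) * m ∸ 1) ⊓ n) + m       ≤⟨ +-monoˡ-≤ m (≤-trans (m⊓n≤m _ n) (m∸n≤m _ 1)) ⟩
      (k + 3) * m + m                   ≡⟨ +-comm _ m ⟩
      (suc (k + 3)) * m                 ≡⟨ cong (_* m) (sym (+-suc k 3)) ⟩
      (k + 4) * m                       ∎

cuts : {A : Set} → ℕ → List (List A) → List ℕ
cuts s []          = []
cuts s (f ∷ [])    = []
cuts s (f ∷ g ∷ G) = (s + length f) ∷ cuts (s + length f) (g ∷ G)

length-cuts : {A : Set} (s : ℕ) (F : List (List A)) → length (cuts s F) ≡ length F ∸ 1
length-cuts s []          = refl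
length-cuts s (f ∷ [])    = refl
length-cuts s (f ∷ g ∷ G) = cong suc (length-cuts (s + length f) (g ∷ G))

straddlesCut : {A : Set} (s : ℕ) (F : List (List A)) {i j : ℕ} →
  s < i → i ≤ j → j ≤ s + length (concat F) →
  ¬ Any ((i , j) ⊆I_) (factorIntervalsFrom s F) →
  Any (λ b → i ≤ b × b < j) (cuts s F)
straddlesCut s [] {j = j} s<i i≤j j≤s+0 _ =
  ⊥-elim (<-irrefl refl (<-≤-trans s<i (≤-trans i≤j (subst (j ≤_) (+-identityʳ s) j≤s+0))))
straddlesCut s (f ∷ []) {j = j} s<i i≤j j≤end notWithin =
  ⊥-elim (notWithin (here (s<i , subst (j ≤_) lastEnd j≤end)))
  where
  lastEnd : s + length (f ++ []) ≡ s + length f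
  lastEnd = cong (s +_) (trans (length-++ f) (+-identityʳ _))
straddlesCut s (f ∷ g ∷ G) {i} {j} s<i i≤j j≤end notWithin =
  locate (j ≤? s + length f) (i ≤? s + length f) (λ e<i →
    straddlesCut (s + length f) (g ∷ G) e<i i≤j
      (subst (j ≤_) (trans (cong (s +_) (length-++ f)) (sym (+-assoc s _ _))) j≤end)
      (notWithin ∘ there))
  where
  -- [i..j] either ends within f, or crosses the cut after f, or starts
  -- after f, in which case the remaining factors provide the cut.
  locate : Dec (j ≤ s + length f) → Dec (i ≤ s + length f) →
    (s + length f < i → Any (λ b → i ≤ b × b < j) (cuts (s + length f) (g ∷ G))) →
    Any (λ b → i ≤ b × b < j) (cuts s (f ∷ g ∷ G))
  locate (yes j≤e) _         _    = ⊥-elim (notWithin (here (s<i , j≤e)))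
  locate (no  j≰e) (yes i≤e) _    = here (i≤e , ≰⇒> j≰e)
  locate (no  _)   (no  i≰e) rest = there (rest (≰⇒> i≰e))

reducedStepHit : {A : Set} (n m : ℕ) (F : List (List A)) → length (concat F) ≡ n → ∀ k →
  NonEmptyI (stairStep n m k) → ¬ WithinOneFactor F (extend n m (stairStep n m k)) →
  Windows.Hit m (cuts 0 F) k
reducedStepHit n m F |F|≡n k nonEmpty notWithin =
  Any.map (λ (i≤b , b<j) → stretchInWindow n k _ i≤b b<j)
    (straddlesCut 0 F (m≤n+m 1 (k * m)) i≤j (subst (_ ≤_) (sym |F|≡n) (m⊓n≤n _ n)) notWithin)
  where
  open Windows m
  i≤j : k * m + 1 ≤ ((((k + 3) * m ∸ 1) ⊓ n) + m) ⊓ n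
  i≤j = ⊓-glb (≤-trans nonEmpty (m≤m+n _ m)) (≤-trans nonEmpty (m⊓n≤n _ n))

-- Each step kept by Reduce comes
-- from an index k ≤ max(0, ⌈n/m⌉ - 3) with a cut in its window, and the
-- indices 0, 1, 2, … form a strictly increasing list.
mainTheorem5 : {A : Set} (w : List A) (m : ℕ) (F : List (List A)) →
    1 ≤ m → m ≤ length w → IsFactorization w F →
    length (reduce (length w) m (staircase (length w) m) F) ≤ 4 * (length F ∸ 1)
mainTheorem5 w m F _ _ (concatF≡w , _) = begin
  length (reduce n m (staircase n m) F)
    ≤⟨ length-filter²-map _ nonEmptyI? (hit? (cuts 0 F)) (stairStep n m)
         (reducedStepHit n m F (cong length concatF≡w)) (upTo N) ⟩
  length (filter (hit? (cuts 0 F)) (upTo N))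
    ≤⟨ countHits (cuts 0 F) (AllPairs.applyUpTo⁺₁ id N (λ i<j _ → i<j)) ⟩
  4 * length (cuts 0 F)
    ≡⟨ cong (4 *_) (length-cuts 0 F) ⟩
  4 * (length F ∸ 1) ∎
  where
  open ≤-Reasoning
  open Windows m
  n N : ℕ
  n = length w
  N = suc (ceilDiv n m ∸ 3)
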